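{- Let $G$ be a finite bipartite graph. Then $G$ contains an edge-asteroid if and only if the complement $\overline{I(G)}$ of its independence graph contains an asteroid.
   Context: Let $G$ be a bipartite graph with bipartition $(X,Y)$. Two edges $xy, x'y'$ of $G$ ($x,x'\in X$, $y,y'\in Y$) are independent if they are disjoint and neither $xy'$ nor $x'y$ is an edge of $G$. The independence graph $I(G)$ has vertex set $E(G)$, two edges of $G$ being adjacent in $I(G)$ iff they are independent; $\overline{I(G)}$ is its complement. An edge-asteroid in $G$ is a set of an odd number $2k+1$ ($k\ge1$) of edges $e_0,e_1,\dots,e_{2k}$ such that for each $i=0,\dots,2k$ there is a walk joining $e_{i+k}$ and $e_{i+k+1}$ (a walk containing both end vertices of $e_{i+k}$ and both end vertices of $e_{i+k+1}$) that contains no vertex adjacent to either end vertex of $e_i$ (indices modulo $2k+1$). An asteroid in a graph $H$ is a set of $2k+1$ vertices $v_0,\dots,v_{2k}$ ($k\ge1$) such that for each $i$ there is a path joining $v_{i+k}$ and $v_{i+k+1}$ none of whose vertices is a neighbour of $v_i$ (indices modulo $2k+1$). -}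

module Defs where

open import Data.Nat using (ℕ; suc; _+_; _*_; _≤_)
open import Data.Nat.DivMod using (_mod_)
open import Data.Fin using (Fin; toℕ)
open import Data.Bool using (Bool; true)
open import Data.Sum using (_⊎_; inj₁; inj₂)
open import Data.Product using (Σ; _×_; _,_; proj₁; proj₂; ∃-syntax)
open import Data.Empty using (⊥)
open import Data.Maybe using (just)
open import Data.List using (List; []; _∷_; last)
open import Data.List.Membership.Propositional using (_∈_)
open import Data.List.Relation.Unary.All using (All)
open import Data.List.Relation.Unary.Linked using (Linked)
open import Data.List.Relation.Unary.Unique.Propositional using (Unique)
open import Relation.Binary.PropositionalEquality using (_≡_)
open import Relation.Nullary using (¬_)
open import Function.Definitions using (Injective)

-- A finite bipartite graph with bipartition (X , Y), X = Fin m, Y = Fin n;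
-- E x y = true  iff  xy is an edge.
record BipGraph : Set where
  field
    m n : ℕ
    E   : Fin m → Fin n → Bool

shift : (k : ℕ) → Fin (suc (2 * k)) → ℕ → Fin (suc (2 * k))
shift k i j = (toℕ i + j) mod (suc (2 * k))

module _ (G : BipGraph) where
  open BipGraph G

  V : Set
  V = Fin m ⊎ Fin n

  Adj : V → V → Set
  Adj (inj₁ x) (inj₂ y) = E x y ≡ true
  Adj (inj₂ y) (inj₁ x) = E x y ≡ true
  Adj _ _ = ⊥

  Edge : Set
  Edge = Σ (Fin m × Fin n) λ p → E (proj₁ p) (proj₂ p) ≡ true

  xEnd : Edge → Fin m
  xEnd e = proj₁ (proj₁ e)

  yEnd : Edge → Fin n
  yEnd e = proj₂ (proj₁ e)

  Independent : Edge → Edge → Set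
  Independent e f =
    ¬ (xEnd e ≡ xEnd f) × ¬ (yEnd e ≡ yEnd f)
    × ¬ (E (xEnd e) (yEnd f) ≡ true) × ¬ (E (xEnd f) (yEnd e) ≡ true)

  -- adjacency in the complement of the independence graph I(G)
  -- (simple graph: distinct vertices that are not adjacent in I(G))
  CoIAdj : Edge → Edge → Set
  CoIAdj e f = ¬ (e ≡ f) × ¬ Independent e f

  IsWalk : List V → Set
  IsWalk = Linked Adj

  WalkJoins : List V → Edge → Edge → Set
  WalkJoins w e f =
    inj₁ (xEnd e) ∈ w × inj₂ (yEnd e) ∈ w × inj₁ (xEnd f) ∈ w × inj₂ (yEnd f) ∈ w

  AvoidsG : List V → Edge → Set
  AvoidsG w e = All (λ v → ¬ Adj v (inj₁ (xEnd e)) × ¬ Adj v (inj₂ (yEnd e))) w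

  HasEdgeAsteroid : Set
  HasEdgeAsteroid =
    ∃[ k ] 1 ≤ k × ∃[ e ] (Injective _≡_ _≡_ e ×
      ((i : Fin (suc (2 * k))) →
        ∃[ w ] IsWalk w
          × WalkJoins w (e (shift k i k)) (e (shift k i (suc k)))
          × AvoidsG w (e i)))

  IsCoIPath : List Edge → Edge → Edge → Set
  IsCoIPath [] u v = ⊥
  IsCoIPath (a ∷ p) u v =
    a ≡ u × last (a ∷ p) ≡ just v × Linked CoIAdj (a ∷ p) × Unique (a ∷ p)

  CoIHasAsteroid : Set
  CoIHasAsteroid =
    ∃[ k ] 1 ≤ k × ∃[ v ] (Injective _≡_ _≡_ v ×
      ((i : Fin (suc (2 * k))) →
        ∃[ p ] IsCoIPath p (v (shift k i k)) (v (shift k i (suc k)))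
          × All (λ u → ¬ CoIAdj u (v i)) p))

-- Both notions use the same data: an injective family e₀ … e₂ₖ of edges and,
-- for every i, a connection between e_{i+k} and e_{i+k+1} that stays away
-- from e_i.  So the theorem follows from a local correspondence for one
-- fixed edge e:
--
--   * an edge g of G avoids N(e) (neither end is adjacent to an end of e)
--     iff g is independent of e;
--   * a walk in G avoiding N(e) and joining u, v yields a walk from u to v
--     in co-I(G) through edges independent of e (consecutive edges of a walk
--     share a vertex, so they are equal or not independent); erasing loops
--     turns it into a path, and independent edges are not co-I-neighbours
--     of e;
--   * conversely, on a co-I path from u to v (u ≠ v) avoiding the closed
--     neighbourhood of e all edges are independent of e, and two co-I-adjacent
--     such edges are linked by a walk of length ≤ 3 in G avoiding N(e).
module Submission where

open import Defs
open import Function.Bundles using (_⇔_; mk⇔)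
open import Data.Nat using (ℕ; suc; _+_; _*_; _≤_; s≤s; NonZero)
open import Data.Nat.DivMod using (_%_; _/_; m≡m%n+[m/n]*n; [m+kn]%n≡m%n; m<n⇒m%n≡m; m%n<n; n%n≡0)
open import Data.Nat.Properties using (+-suc; 1+n≢n; m≤n⇒m<n∨m≡n; ≤-trans; m≤m+n)
open import Data.Fin as Fin using (Fin; toℕ)
open import Data.Fin.Properties using (toℕ-fromℕ<)
open import Data.Bool as Bool using (true)
open import Data.Sum using (_⊎_; inj₁; inj₂)
open import Data.Product using (Σ; _×_; _,_; proj₁; proj₂; ∃-syntax)
open import Data.Product.Properties using (≡-dec)
open import Data.Maybe using (just)
open import Data.List using (List; []; _∷_; last)
open import Data.List.Membership.Propositional using (_∈_; _∉_)
open import Data.List.Relation.Unary.Any using (here; there)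
open import Data.List.Relation.Unary.All as All using (All; []; _∷_)
open import Data.List.Relation.Unary.All.Properties using (¬Any⇒All¬)
open import Data.List.Relation.Unary.AllPairs using ([]; _∷_)
open import Data.List.Relation.Unary.Linked using (Linked; [-]; _∷_)
open import Data.List.Relation.Unary.Unique.Propositional using (Unique)
import Data.List.Membership.DecPropositional as DecMembership
open import Relation.Binary.Construct.Closure.Reflexive using (ReflClosure; [_]) renaming (refl to stay)
open import Relation.Binary.Definitions using (DecidableEquality)
open import Relation.Binary.PropositionalEquality using (_≡_; _≢_; refl; sym; trans; cong; subst; module ≡-Reasoning)
open import Relation.Nullary using (¬_; Dec; yes; no; contradiction)
open import Relation.Nullary.Decidable using (_×-dec_; ¬?; decidable-stable)
open import Axiom.UniquenessOfIdentityProofs using (module Decidable⇒UIP)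

module Walks {A : Set} where

  data Walk (R : A → A → Set) (P : A → Set) : A → A → Set where
    one  : ∀ {a} → P a → Walk R P a a
    step : ∀ {a b c} → R a b → P a → Walk R P b c → Walk R P a c

  module _ {R : A → A → Set} {P : A → Set} where

    -- The vertex list of a walk.  It is syntactically a cons headed by the
    -- start vertex, so that the list-based notions of Defs (IsCoIPath) compute
    -- on it.
    vertices      : ∀ {a b} → Walk R P a b → List A
    laterVertices : ∀ {a b} → Walk R P a b → List A
    vertices {a} w = a ∷ laterVertices w
    laterVertices (one _)      = []
    laterVertices (step _ _ w) = vertices w

    vertices-linked : ∀ {a b} (w : Walk R P a b) → Linked R (vertices w)
    vertices-linked (one _)      = [-]
    vertices-linked (step r _ w) = r ∷ vertices-linked w

    vertices-all : ∀ {a b} (w : Walk R P a b) → All P (vertices w)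
    vertices-all (one p)      = p ∷ []
    vertices-all (step _ p w) = p ∷ vertices-all w

    vertices-last : ∀ {a b} (w : Walk R P a b) → last (vertices w) ≡ just b
    vertices-last (one _)      = refl
    vertices-last (step _ _ w) = vertices-last w

    target∈ : ∀ {a b} (w : Walk R P a b) → b ∈ vertices w
    target∈ (one _)      = here refl
    target∈ (step _ _ w) = there (target∈ w)

    first : ∀ {a b} → Walk R P a b → P a
    first (one p)      = p
    first (step _ p _) = p

    _++ʷ_ : ∀ {a b c} → Walk R P a b → Walk R P b c → Walk R P a c
    one _      ++ʷ w′ = w′
    step r p w ++ʷ w′ = step r p (w ++ʷ w′)

    ∈-++ʷˡ : ∀ {a b c x} (w : Walk R P a b) (w′ : Walk R P b c) →
             x ∈ vertices w → x ∈ vertices (w ++ʷ w′)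
    ∈-++ʷˡ _            _  (here x≡a)  = here x≡a
    ∈-++ʷˡ (step _ _ w) w′ (there x∈w) = there (∈-++ʷˡ w w′ x∈w)

    ∈-++ʷʳ : ∀ {a b c x} (w : Walk R P a b) (w′ : Walk R P b c) →
             x ∈ vertices w′ → x ∈ vertices (w ++ʷ w′)
    ∈-++ʷʳ (one _)      w′ x∈w′ = x∈w′
    ∈-++ʷʳ (step _ _ w) w′ x∈w′ = there (∈-++ʷʳ w w′ x∈w′)

    reverse : (∀ {x y} → R x y → R y x) → ∀ {a b} → Walk R P a b → Walk R P b a
    reverse sym-R (one p)      = one p
    reverse sym-R (step r p w) = reverse sym-R w ++ʷ step (sym-R r) (first w) (one p)

    prefix : ∀ {a z t} → Linked R (a ∷ t) → All P (a ∷ t) → z ∈ a ∷ t → Walk R P a z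
    prefix _       (p ∷ _)  (here refl)  = one p
    prefix [-]     _        (there ())
    prefix (r ∷ l) (p ∷ ps) (there z∈t)  = step r p (prefix l ps z∈t)

    module _ {Q : A → Set} (step-Q : ∀ {x y} → R x y → P x → P y → Q x × Q y) where

      retagFrom : ∀ {a b c} → R a b → P a → Walk R P b c → Walk R Q a c
      retagFrom r pa (one pb) = step r (proj₁ (step-Q r pa pb)) (one (proj₂ (step-Q r pa pb)))
      retagFrom r pa (step r′ pb w) = step r (proj₁ (step-Q r pa pb)) (retagFrom r′ pb w)

      retag : ∀ {a b} → Walk R P a b → a ≢ b → Walk R Q a b
      retag (one _)      a≢a = contradiction refl a≢a
      retag (step r p w) _   = retagFrom r p w

  last-∈ : ∀ {v} (xs : List A) → last xs ≡ just v → v ∈ xs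
  last-∈ (x ∷ [])     refl = here refl
  last-∈ (x ∷ y ∷ ys) eq   = there (last-∈ (y ∷ ys) eq)

  module LoopErasure (_≟_ : DecidableEquality A) {R : A → A → Set} {P : A → Set} where
    open DecMembership _≟_ using (_∈?_)

    Path : A → A → Set
    Path a b = Σ (Walk R P a b) λ w → Unique (vertices w)

    suffix : ∀ {a b c} (p : Path b c) → a ∈ vertices (proj₁ p) → Path a c
    suffix p                       (here refl) = p
    suffix (step _ _ w , _ ∷ uniq) (there a∈w) = suffix (w , uniq) a∈w

    extend : ∀ {a b c} → ReflClosure R a b → P a → (p : Path b c) → a ∉ vertices (proj₁ p) → Path a c
    extend stay  _ _ a∉p = contradiction (here refl) a∉p
    extend [ r ] pa (w , uniq) a∉p = step r pa w , ¬Any⇒All¬ (vertices w) a∉p ∷ uniq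

    eraseLoops : ∀ {a b} → Walk (ReflClosure R) P a b → Path a b
    eraseLoops (one p) = one p , [] ∷ []
    eraseLoops {a} (step r pa w) with eraseLoops w
    ... | p with a ∈? vertices (proj₁ p)
    ...   | yes a∈p = suffix p a∈p
    ...   | no  a∉p = extend r pa p a∉p

open Walks

suc-% : ∀ a N .{{_ : NonZero N}} → suc a % N ≡ suc (a % N) % N
suc-% a N = begin
  suc a % N                     ≡⟨ cong (λ t → suc t % N) (m≡m%n+[m/n]*n a N) ⟩
  (suc (a % N) + a / N * N) % N ≡⟨ [m+kn]%n≡m%n (suc (a % N)) (a / N) N ⟩
  suc (a % N) % N               ∎
  where open ≡-Reasoning

-- Consecutive naturals have different residues modulo any N ≥ 2: either
-- a % N + 1 < N is its own residue, or a % N + 1 = N wraps to 0, forcing N = 1.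
%-suc-≢ : ∀ a N .{{_ : NonZero N}} → 2 ≤ N → a % N ≢ suc a % N
%-suc-≢ a N 2≤N r≡r′ with m≤n⇒m<n∨m≡n (m%n<n a N)
... | inj₁ 1+r<N = 1+n≢n (sym (trans r≡r′ (trans (suc-% a N) (m<n⇒m%n≡m 1+r<N))))
... | inj₂ 1+r≡N = 2≰1 (subst (2 ≤_) (trans (sym 1+r≡N) (cong suc r≡0)) 2≤N)
  where
  r≡0 : a % N ≡ 0
  r≡0 = trans r≡r′ (trans (suc-% a N) (trans (cong (_% N) 1+r≡N) (n%n≡0 N)))
  2≰1 : ¬ 2 ≤ 1
  2≰1 (s≤s ())

shift-distinct : (k : ℕ) → 1 ≤ k → (i : Fin (suc (2 * k))) → shift k i k ≢ shift k i (suc k)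
shift-distinct k 1≤k i eq = %-suc-≢ (toℕ i + k) N 2≤N (begin
  (toℕ i + k) % N            ≡⟨ toℕ-fromℕ< _ ⟨
  toℕ (shift k i k)          ≡⟨ cong toℕ eq ⟩
  toℕ (shift k i (suc k))    ≡⟨ toℕ-fromℕ< _ ⟩
  (toℕ i + suc k) % N        ≡⟨ cong (_% N) (+-suc (toℕ i) k) ⟩
  suc (toℕ i + k) % N        ∎)
  where
  open ≡-Reasoning
  N = suc (2 * k)
  2≤N : 2 ≤ N
  2≤N = s≤s (≤-trans 1≤k (m≤m+n k (1 * k)))

module _ (G : BipGraph) where
  open BipGraph G

  -- Edges are decidably equal (the edge proof is a Boolean equality).
  _≟ᴱ_ : DecidableEquality (Edge G)
  _≟ᴱ_ = ≡-dec (≡-dec Fin._≟_ Fin._≟_) (λ p q → yes (Decidable⇒UIP.≡-irrelevant Bool._≟_ p q))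

  adj-sym : ∀ {a b} → Adj G a b → Adj G b a
  adj-sym {inj₁ _} {inj₂ _} ab = ab
  adj-sym {inj₂ _} {inj₁ _} ab = ab

  independent-sym : ∀ {g h} → Independent G g h → Independent G h g
  independent-sym (x≢ , y≢ , xy′ , x′y) = (λ eq → x≢ (sym eq)) , (λ eq → y≢ (sym eq)) , x′y , xy′

  coIAdj-sym : ∀ {g h} → CoIAdj G g h → CoIAdj G h g
  coIAdj-sym {g} {h} (g≢h , ¬ind) = (λ eq → g≢h (sym eq)) , (λ ind → ¬ind (independent-sym {h} {g} ind))

  independent? : ∀ g h → Dec (Independent G g h)
  independent? g h =
    ¬? (xEnd G g Fin.≟ xEnd G h) ×-dec ¬? (yEnd G g Fin.≟ yEnd G h)
    ×-dec ¬? (E (xEnd G g) (yEnd G h) Bool.≟ true) ×-dec ¬? (E (xEnd G h) (yEnd G g) Bool.≟ true)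

  Incident : Edge G → V G → Set
  Incident g v = v ≡ inj₁ (xEnd G g) ⊎ v ≡ inj₂ (yEnd G g)

  shared⇒¬independent : ∀ {g h v} → Incident g v → Incident h v → ¬ Independent G g h
  shared⇒¬independent (inj₁ refl) (inj₁ refl) (x≢ , _) = x≢ refl
  shared⇒¬independent (inj₂ refl) (inj₂ refl) (_ , y≢ , _) = y≢ refl
  shared⇒¬independent (inj₁ refl) (inj₂ ())
  shared⇒¬independent (inj₂ refl) (inj₁ ())

  shared⇒coIAdj : ∀ {g h v} → Incident g v → Incident h v → ReflClosure (CoIAdj G) g h
  shared⇒coIAdj {g} {h} g∋v h∋v with g ≟ᴱ h
  ... | yes refl = stay
  ... | no  g≢h  = [ g≢h , shared⇒¬independent {g} {h} g∋v h∋v ]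

  module Relative (e : Edge G) where

    Avoids : V G → Set
    Avoids v = ¬ Adj G v (inj₁ (xEnd G e)) × ¬ Adj G v (inj₂ (yEnd G e))

    IndepOfE : Edge G → Set
    IndepOfE g = Independent G g e

    avoids⇒independent : ∀ g → Avoids (inj₁ (xEnd G g)) → Avoids (inj₂ (yEnd G g)) → IndepOfE g
    avoids⇒independent ((x , y) , xy) (_ , ¬xy₀) (¬x₀y , _) =
      (λ { refl → ¬x₀y xy }) , (λ { refl → ¬xy₀ xy }) , ¬xy₀ , ¬x₀y

    independent⇒avoidsˣ : ∀ g → IndepOfE g → Avoids (inj₁ (xEnd G g))
    independent⇒avoidsˣ g (_ , _ , ¬xy₀ , _) = (λ ()) , ¬xy₀

    independent⇒avoidsʸ : ∀ g → IndepOfE g → Avoids (inj₂ (yEnd G g))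
    independent⇒avoidsʸ g (_ , _ , _ , ¬x₀y) = ¬x₀y , (λ ())

    independent⇒¬coIAdj : ∀ {g} → IndepOfE g → ¬ CoIAdj G g e
    independent⇒¬coIAdj ind (_ , ¬ind) = ¬ind ind

    -- A co-I-neighbour of some edge that is not a co-I-neighbour of e is
    -- different from e, hence (independence being decidable) independent of e.
    coIAdj⇒independent : ∀ {g h} → CoIAdj G g h → ¬ CoIAdj G g e → ¬ CoIAdj G h e → IndepOfE g
    coIAdj⇒independent {g} g~h g≁e h≁e =
      decidable-stable (independent? g e) (λ ¬ind → g≁e (g≢e , ¬ind))
      where
      g≢e : g ≢ e
      g≢e refl = h≁e (coIAdj-sym g~h)

    edgeOfStep : ∀ {a c} → Adj G a c → Avoids a → Avoids c →
                 Σ (Edge G) λ g → Incident g a × Incident g c × IndepOfE g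
    edgeOfStep {inj₁ x} {inj₂ y} xy ax ay = ((x , y) , xy) , inj₁ refl , inj₂ refl , avoids⇒independent ((x , y) , xy) ax ay
    edgeOfStep {inj₂ y} {inj₁ x} xy ay ax = ((x , y) , xy) , inj₂ refl , inj₁ refl , avoids⇒independent ((x , y) , xy) ax ay

    edgeWalk : ∀ {a b} → Walk (Adj G) Avoids a b →
               (g : Edge G) → Incident g a → IndepOfE g →
               (h : Edge G) → Incident h b → IndepOfE h →
               Walk (ReflClosure (CoIAdj G)) IndepOfE g h
    edgeWalk (one _) g g∋a ig h h∋a ih = step (shared⇒coIAdj g∋a h∋a) ig (one ih)
    edgeWalk (step a~c pa w) g g∋a ig h h∋b ih with edgeOfStep a~c pa (first w)
    ... | g′ , g′∋a , g′∋c , ig′ = step (shared⇒coIAdj g∋a g′∋a) ig (edgeWalk w g′ g′∋c ig′ h h∋b ih)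

    open LoopErasure _≟ᴱ_ using (Path; eraseLoops)

    walk⇒coIPath : ∀ u v → (∃[ w ] IsWalk G w × WalkJoins G w u v × AvoidsG G w e) →
                   ∃[ p ] IsCoIPath G p u v × All (λ z → ¬ CoIAdj G z e) p
    walk⇒coIPath u v ((h ∷ t) , linked , (xu∈ , yu∈ , xv∈ , yv∈) , avoids) =
      vertices path , (refl , vertices-last path , vertices-linked path , unique) ,
      All.map independent⇒¬coIAdj (vertices-all path)
      where
      xu→xv : Walk (Adj G) Avoids (inj₁ (xEnd G u)) (inj₁ (xEnd G v))
      xu→xv = reverse adj-sym (prefix linked avoids xu∈) ++ʷ prefix linked avoids xv∈
      u-indep = avoids⇒independent u (All.lookup avoids xu∈) (All.lookup avoids yu∈)
      v-indep = avoids⇒independent v (All.lookup avoids xv∈) (All.lookup avoids yv∈)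
      shortened : Path u v
      shortened = eraseLoops (edgeWalk xu→xv u (inj₁ refl) u-indep v (inj₁ refl) v-indep)
      path = proj₁ shortened
      unique = proj₂ shortened

    alongEdge : ∀ g → IndepOfE g → Walk (Adj G) Avoids (inj₁ (xEnd G g)) (inj₂ (yEnd G g))
    alongEdge g ig = step (proj₂ g) (independent⇒avoidsˣ g ig) (one (independent⇒avoidsʸ g ig))

    -- Two non-independent edges g, h, both independent of e, are linked in G
    -- by a walk from y_g to x_h avoiding N(e): through a shared end, a direct
    -- edge y_g x_h, or the path y_g x_g y_h x_h.
    bridge : ∀ g h → CoIAdj G g h → IndepOfE g → IndepOfE h →
             Walk (Adj G) Avoids (inj₂ (yEnd G g)) (inj₁ (xEnd G h))
    bridge g h (_ , ¬ind) ig ih =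
      link g h ¬ind (independent⇒avoidsˣ g ig) (independent⇒avoidsʸ g ig)
                    (independent⇒avoidsˣ h ih) (independent⇒avoidsʸ h ih)
      where
      link : ∀ g h → ¬ Independent G g h →
             Avoids (inj₁ (xEnd G g)) → Avoids (inj₂ (yEnd G g)) →
             Avoids (inj₁ (xEnd G h)) → Avoids (inj₂ (yEnd G h)) →
             Walk (Adj G) Avoids (inj₂ (yEnd G g)) (inj₁ (xEnd G h))
      link ((x , y) , xy) ((x′ , y′) , x′y′) ¬ind xg yg xh yh
        with x Fin.≟ x′ | y Fin.≟ y′ | E x′ y Bool.≟ true | E x y′ Bool.≟ true
      ... | yes refl | _        | _       | _       = step xy yg (one xg)
      ... | no _     | yes refl | _       | _       = step x′y′ yg (one xh)
      ... | no _     | no _     | yes x′y | _       = step x′y yg (one xh)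
      ... | no _     | no _     | no _    | yes xy′ = step {b = inj₁ x} xy yg (step {b = inj₂ y′} xy′ xg (step x′y′ yh (one xh)))
      ... | no x≢x′  | no y≢y′  | no ¬x′y | no ¬xy′ = contradiction (x≢x′ , y≢y′ , ¬xy′ , ¬x′y) ¬ind

    liftWalk : ∀ {g v} → Walk (CoIAdj G) IndepOfE g v →
               Σ (Walk (Adj G) Avoids (inj₁ (xEnd G g)) (inj₂ (yEnd G v))) λ w →
                 inj₂ (yEnd G g) ∈ vertices w × inj₁ (xEnd G v) ∈ vertices w
    liftWalk {g} (one ig) = alongEdge g ig , there (here refl) , here refl
    liftWalk {g} (step {b = h} g~h ig w) with liftWalk w
    ... | w′ , _ , xv∈w′ =
      alongEdge g ig ++ʷ rest , ∈-++ʷˡ (alongEdge g ig) rest (there (here refl)) ,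
      ∈-++ʷʳ (alongEdge g ig) rest (∈-++ʷʳ (bridge g h g~h ig (first w)) w′ xv∈w′)
      where rest = bridge g h g~h ig (first w) ++ʷ w′

    coIPath⇒walk : ∀ u v → u ≢ v → (∃[ p ] IsCoIPath G p u v × All (λ z → ¬ CoIAdj G z e) p) →
                   ∃[ w ] IsWalk G w × WalkJoins G w u v × AvoidsG G w e
    coIPath⇒walk u v u≢v ((a ∷ t) , (refl , last≡v , linked , _) , avoids) =
      vertices w , vertices-linked w , (here refl , yu∈ , xv∈ , target∈ w) , vertices-all w
      where
      coWalk : Walk (CoIAdj G) (λ z → ¬ CoIAdj G z e) u v
      coWalk = prefix linked avoids (last-∈ (a ∷ t) last≡v)
      independentWalk : Walk (CoIAdj G) IndepOfE u v
      independentWalk = retag (λ g~h g≁e h≁e → coIAdj⇒independent g~h g≁e h≁e ,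
                                               coIAdj⇒independent (coIAdj-sym g~h) h≁e g≁e)
                              coWalk u≢v
      lifted = liftWalk independentWalk
      w = proj₁ lifted
      yu∈ = proj₁ (proj₂ lifted)
      xv∈ = proj₂ (proj₂ lifted)


proposition1p2 : (G : BipGraph) → HasEdgeAsteroid G ⇔ CoIHasAsteroid G
proposition1p2 G = mk⇔ to from
  where
  to : HasEdgeAsteroid G → CoIHasAsteroid G
  to (k , 1≤k , e , e-inj , walks) =
    k , 1≤k , e , e-inj , λ i → Relative.walk⇒coIPath G (e i) _ _ (walks i)
  from : CoIHasAsteroid G → HasEdgeAsteroid G
  from (k , 1≤k , e , e-inj , paths) =
    k , 1≤k , e , e-inj ,
    λ i → Relative.coIPath⇒walk G (e i) _ _ (λ eq → shift-distinct k 1≤k i (e-inj eq)) (paths i)
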